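{- Let $G,H$ be graphs with no isolated vertices, and let $P_G$, $P_H$ be pleats of $G$ and $H$ respectively. Then the product graph $P_G\times P_H$ is stiff.
   Context: A graph is a finite undirected graph, loops allowed, at most one edge between two vertices; a graph morphism is a vertex map preserving edges. A vertex is isolated if it has no neighbors (in particular it is not looped). $N(u)$ is the set of vertices adjacent to $u$ ($u\in N(u)$ iff $u$ is looped). The (categorical) product $G\times H$ has vertex set $V(G)\times V(H)$ and $(v_1,w_1)\text{ --- }(v_2,w_2)$ iff $v_1\text{ --- }v_2$ in $G$ and $w_1\text{ --- }w_2$ in $H$. The exponential graph $H^G$ has as vertices the set maps $V(G)\to V(H)$, with $f\text{ --- }g$ iff $f(v_1)\text{ --- }g(v_2)$ for every edge $v_1\text{ --- }v_2$ of $G$. Morphisms $f,g$ are homotopic if joined by a sequence of morphisms consecutive ones adjacent in $H^G$; graphs are homotopy equivalent if there are morphisms $f:G\to H$, $g:H\to G$ with $gf$, $fg$ homotopic to the identities. A graph is stiff if there are no two distinct vertices $v,w$ with $N(v)\subseteq N(w)$. A pleat of $G$ is a stiff graph homotopy equivalent to $G$. -}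

module Defs where

open import Data.Nat using (ℕ)
open import Data.Fin using (Fin)
open import Data.Bool using (Bool; true; _∧_)
open import Data.Product using (_×_; _,_; ∃; Σ)
open import Relation.Binary.PropositionalEquality using (_≡_; _≢_)
open import Relation.Binary.Construct.Closure.ReflexiveTransitive using (Star)
open import Relation.Nullary using (¬_)
open import Function.Bundles using (_↔_)

-- A graph: undirected (symmetric adjacency), loops allowed (adj v v may be true),
-- at most one edge between two vertices (adjacency is a Bool).
record Graph : Set₁ where
  field
    V   : Set
    adj : V → V → Bool
    adj-sym : ∀ u v → adj u v ≡ adj v u

open Graph public

Edge : (G : Graph) → V G → V G → Set
Edge G u v = adj G u v ≡ true

Finite : Graph → Set
Finite G = ∃ λ (n : ℕ) → V G ↔ Fin n

Isolated : (G : Graph) → V G → Set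
Isolated G v = ∀ u → ¬ Edge G v u

NoIsolated : Graph → Set
NoIsolated G = ∀ v → ¬ Isolated G v

IsMorphism : (G H : Graph) → (V G → V H) → Set
IsMorphism G H f = ∀ u v → Edge G u v → Edge H (f u) (f v)

Hom : Graph → Graph → Set
Hom G H = Σ (V G → V H) (IsMorphism G H)

ExpAdj : (G H : Graph) → (V G → V H) → (V G → V H) → Set
ExpAdj G H f g = ∀ v₁ v₂ → Edge G v₁ v₂ → Edge H (f v₁) (g v₂)

Homotopic : (G H : Graph) → Hom G H → Hom G H → Set
Homotopic G H = Star (λ (f g : Hom G H) → ExpAdj G H (Data.Product.proj₁ f) (Data.Product.proj₁ g))

idHom : (G : Graph) → Hom G G
idHom G = (λ v → v) , (λ u v e → e)

compH : (G H K : Graph) → Hom H K → Hom G H → Hom G K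
compH G H K (g , pg) (f , pf) = (λ v → g (f v)) , (λ u v e → pg (f u) (f v) (pf u v e))

HomotopyEquivalent : Graph → Graph → Set
HomotopyEquivalent G H =
  Σ (Hom G H) λ f → Σ (Hom H G) λ g →
    Homotopic G G (compH G H G g f) (idHom G) × Homotopic H H (compH H G H f g) (idHom H)

Stiff : Graph → Set
Stiff G = ∀ v w → v ≢ w → ¬ (∀ u → Edge G v u → Edge G w u)

IsPleat : Graph → Graph → Set
IsPleat P G = Stiff P × HomotopyEquivalent G P

_×G_ : Graph → Graph → Graph
G ×G H = record
  { V = V G × V H
  ; adj = λ { (a , b) (c , d) → adj G a c ∧ adj H b d }
  ; adj-sym = λ { (a , b) (c , d) → cong₂∧ (adj-sym G a c) (adj-sym H b d) }
  }
  where
  open import Relation.Binary.PropositionalEquality using (cong₂)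
  cong₂∧ : ∀ {x y z w} → x ≡ y → z ≡ w → (x ∧ z) ≡ (y ∧ w)
  cong₂∧ = cong₂ _∧_

module Submission where

-- The proof uses only two facts about a pleat P of a graph G without
-- isolated vertices: P is stiff, and there are morphisms G → P and P → G.
--
--  * A stiff graph with an isolated vertex v has no edges, since an endpoint
--    w of an edge differs from v while N(v) = ∅ ⊆ N(w); so all its vertices
--    are isolated.
--  * The image of a vertex under a morphism out of a graph without isolated
--    vertices is not isolated.  For a pleat P with morphisms f : G → P and
--    g : P → G and an isolated vertex v of P, the vertex f (g v) would then be
--    both isolated and not isolated; so P has no isolated vertices.
--  * A product P × Q of stiff graphs without isolated vertices is stiff:
--    if N(a,b) ⊆ N(c,d), pick neighbours x of a and y of b; testing the
--    inclusion on the neighbours (u,y) and (x,u) gives N(a) ⊆ N(c) and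
--    N(b) ⊆ N(d), so a = c and b = d by stiffness of the factors.

open import Defs
open import Data.Product using (_,_; proj₁)
open import Data.Bool using (_∧_)
open import Data.Bool.Properties using (∧-conicalˡ; ∧-conicalʳ)
open import Data.Empty using (⊥-elim)
open import Relation.Nullary using (¬_)
open import Relation.Binary.PropositionalEquality using (_≢_; sym; subst; cong₂)

product-edge : (P Q : Graph) {a c : V P} {b d : V Q} →
  Edge P a c → Edge Q b d → Edge (P ×G Q) (a , b) (c , d)
product-edge P Q = cong₂ _∧_

product-edge₁ : (P Q : Graph) {a c : V P} {b d : V Q} →
  Edge (P ×G Q) (a , b) (c , d) → Edge P a c
product-edge₁ P Q {a} {c} {b} {d} = ∧-conicalˡ (adj P a c) (adj Q b d)

product-edge₂ : (P Q : Graph) {a c : V P} {b d : V Q} →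
  Edge (P ×G Q) (a , b) (c , d) → Edge Q b d
product-edge₂ P Q {a} {c} {b} {d} = ∧-conicalʳ (adj P a c) (adj Q b d)

stiff-isolated⇒edgeless : (P : Graph) → Stiff P →
  ∀ v → Isolated P v → ∀ w u → ¬ Edge P w u
stiff-isolated⇒edgeless P stiff v isolated w u w—u =
  stiff v w v≢w (λ x v—x → ⊥-elim (isolated x v—x))
  where
  v≢w : v ≢ w
  v≢w v≡w = isolated u (subst (λ z → Edge P z u) (sym v≡w) w—u)

morphism-avoids-isolated : (G P : Graph) → NoIsolated G →
  ((f , _) : Hom G P) → ∀ v → ¬ Isolated P (f v)
morphism-avoids-isolated G P noIsolated (f , f-mor) v isolated =
  noIsolated v (λ u v—u → isolated (f u) (f-mor v u v—u))

stiff-between-noIsolated : (G P : Graph) → Stiff P → NoIsolated G →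
  Hom G P → Hom P G → NoIsolated P
stiff-between-noIsolated G P stiff noIsolated f (g , _) v isolated =
  morphism-avoids-isolated G P noIsolated f (g v)
    (stiff-isolated⇒edgeless P stiff v isolated (proj₁ f (g v)))

pleat-noIsolated : (P G : Graph) → IsPleat P G → NoIsolated G → NoIsolated P
pleat-noIsolated P G (stiff , f , g , _) noIsolated =
  stiff-between-noIsolated G P stiff noIsolated f g

product-stiff : (P Q : Graph) → Stiff P → Stiff Q →
  NoIsolated P → NoIsolated Q → Stiff (P ×G Q)
product-stiff P Q stiffP stiffQ noIsoP noIsoQ (a , b) (c , d) ab≢cd N[ab]⊆N[cd] =
  noIsoP a λ x a—x → noIsoQ b λ y b—y →
    stiffP a c (λ a≡c → stiffQ b d (λ b≡d → ab≢cd (cong₂ _,_ a≡c b≡d)) (N[b]⊆N[d] x a—x))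
      (N[a]⊆N[c] y b—y)
  where
  N[a]⊆N[c] : ∀ y → Edge Q b y → ∀ u → Edge P a u → Edge P c u
  N[a]⊆N[c] y b—y u a—u =
    product-edge₁ P Q (N[ab]⊆N[cd] (u , y) (product-edge P Q a—u b—y))
  N[b]⊆N[d] : ∀ x → Edge P a x → ∀ u → Edge Q b u → Edge Q d u
  N[b]⊆N[d] x a—x u b—u =
    product-edge₂ P Q (N[ab]⊆N[cd] (x , u) (product-edge P Q a—x b—u))

proposition5p5 : (G H PG PH : Graph) →
    Finite G → Finite H → Finite PG → Finite PH →
    NoIsolated G → NoIsolated H →
    IsPleat PG G → IsPleat PH H →
    Stiff (PG ×G PH)
proposition5p5 G H PG PH _ _ _ _ noIsoG noIsoH pleatG pleatH =
  product-stiff PG PH (proj₁ pleatG) (proj₁ pleatH)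
    (pleat-noIsolated PG G pleatG noIsoG) (pleat-noIsolated PH H pleatH noIsoH)
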